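{- For all integers $0 \leq k \leq n$ with $n \ge 1$: (i) $f_k(n) \leq f_{k+1}(n)$; (ii) $f_k(n) \leq f_k(n+1)$; (iii) $(n+1) f_k(n) \leq f_{k+1}(n+1)$.
   Context: Let $S_n$ denote the set of permutations of $\{1,\ldots,n\}$, written in one-line notation as strings $\sigma(1)\sigma(2)\cdots\sigma(n)$. For $\sigma \in S_n$ and $A \subseteq \{1,\ldots,n\}$, $\sigma - A$ denotes the string obtained from $\sigma$ by deleting all symbols in $A$ (and contracting). The Ulam distance is $d_U(\alpha,\beta) = \min\{|A| : \alpha - A = \beta - A\}$ for $\alpha,\beta \in S_n$. For integers $k \ge 0$ and $n \ge 1$, $f_k(n)$ denotes the maximum size of a set $\mathcal{F} \subseteq S_n$ such that $d_U(\alpha,\beta) \leq k$ for all $\alpha,\beta \in \mathcal{F}$. -}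

module Defs where

open import Data.Nat using (ℕ; suc; _≤_)
open import Data.Nat.Properties using (_≟_)
open import Data.List using (List; length; filter; applyUpTo)
open import Data.List.Membership.Propositional using (_∈_)
open import Data.List.Membership.DecPropositional _≟_ using (_∈?_)
open import Data.List.Relation.Unary.All using (All)
open import Data.List.Relation.Unary.Unique.Propositional using (Unique)
open import Data.List.Relation.Binary.Permutation.Propositional using (_↭_)
open import Data.Product using (Σ; ∃; _×_)
open import Relation.Nullary using (¬?)
open import Relation.Binary.PropositionalEquality using (_≡_)

symbols : ℕ → List ℕ
symbols n = applyUpTo suc n

-- σ ∈ S_n : a string (one-line notation) that is a rearrangement of 1,2,…,n
IsPerm : ℕ → List ℕ → Set
IsPerm n σ = σ ↭ symbols n

_-_ : List ℕ → List ℕ → List ℕ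
σ - A = filter (λ x → ¬? (x ∈? A)) σ

-- d_U(α,β) ≤ k, i.e. min{ |A| : A ⊆ {1..n}, α - A = β - A } ≤ k,
-- i.e. there is a set A ⊆ {1,…,n} (a duplicate-free list) with |A| ≤ k and α - A = β - A
UlamLe : ℕ → ℕ → List ℕ → List ℕ → Set
UlamLe n k α β =
  ∃ λ (A : List ℕ) → Unique A × All (_∈ symbols n) A × length A ≤ k × (α - A) ≡ (β - A)

IsKFamily : ℕ → ℕ → List (List ℕ) → Set
IsKFamily k n F =
  Unique F × All (IsPerm n) F × (∀ {α β} → α ∈ F → β ∈ F → UlamLe n k α β)

-- "m = f_k(n)": m is the maximum size of such a family
-- (some family has size m, and every family has size ≤ m)
IsF : ℕ → ℕ → ℕ → Set
IsF k n m =
  (∃ λ F → IsKFamily k n F × length F ≡ m) × (∀ F → IsKFamily k n F → length F ≤ m)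

-- Each inequality comes from transforming a family attaining f_k(n).
-- (i) Every pairwise bound k is also a bound k + 1.
-- (ii) Prefixing every permutation with the new symbol n + 1 keeps the permutations
-- distinct, and every deletion set still works.
-- (iii) Inserting n + 1 at each of the n + 1 positions of each permutation gives
-- (n + 1) f_k(n) distinct permutations of {1,…,n+1}; deleting n + 1 together with a
-- deletion set for the underlying pair makes any two of them equal.
-- The maximum f_k(n) exists because every family can be shrunk to a sublist of the
-- finite list of all words of length n over {1,…,n}, and being a family is decidable.
module Submission where

open import Defs
open import Data.Nat using (ℕ; zero; suc; _≤_; _*_; _≤?_; z≤n; s≤s)
open import Data.Nat.Properties
  using (_≟_; ≤-trans; ≤-refl; ≤-reflexive; <⇒≢; ≤-pred; n≤1+n; suc-injective; *-comm)
open import Data.List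
  using (List; []; _∷_; length; filter; map; _++_; [_]; cartesianProductWith; cartesianProduct; deduplicate; upTo)
open import Data.List.Properties
  using (≡-dec; filter-accept; filter-reject; filter-≐; length-++; length-map; applyUpTo-∷ʳ; length-applyUpTo; length-upTo; ∷-injective; ∷-injectiveʳ; ∷-injectiveˡ)
open import Data.List.Extrema.Nat using (argmax; argmax-all; f[xs]≤f[argmax])
open import Data.List.Membership.Propositional using (_∈_; _∉_; find; lose)
open import Data.List.Membership.Propositional.Properties
  using (∈-map⁺; ∈-map⁻; ∈-++⁺ˡ; ∈-++⁺ʳ; ∈-++⁻; ∈-∃++; ∈-cartesianProductWith⁺; ∈-cartesianProduct⁻; ∈-applyUpTo⁻; ∈-upTo⁻; ∈-filter⁺; ∈-filter⁻; ∈-deduplicate⁺)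
import Data.List.Membership.DecPropositional as DecMembership
open import Data.List.Relation.Binary.Subset.Propositional using (_⊆_)
open import Data.List.Relation.Binary.Permutation.Propositional
  using (_↭_; ↭-sym; ↭-trans; ↭-refl; ↭-prep; ↭-swap; ↭-reflexive)
open import Data.List.Relation.Binary.Permutation.Propositional.Properties
  using (¬x∷xs↭[]; ∈-resp-↭; ↭-length; shift; drop-mid; ++-comm)
open import Data.List.Relation.Unary.All as All using (All; []; _∷_)
open import Data.List.Relation.Unary.All.Properties using (all-filter) renaming (map⁺ to All-map⁺)
open import Data.List.Relation.Unary.Any using (here; there; any?)
open import Data.List.Relation.Unary.AllPairs using ([]; _∷_)
open import Data.List.Relation.Unary.Unique.Propositional using (Unique)
open import Data.List.Relation.Unary.Unique.Propositional.Properties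
  using (applyUpTo⁺₁; cartesianProduct⁺; upTo⁺) renaming (map⁺ to Unique-map⁺; filter⁺ to Unique-filter⁺)
import Data.List.Relation.Unary.Unique.DecPropositional as DecUnique
import Data.List.Relation.Unary.Unique.DecPropositional.Properties as DecUniqueProperties
open import Data.Product using (∃; _×_; _,_; proj₁; proj₂)
open import Data.Sum using (inj₁; inj₂)
open import Function using (_∘_; _⇔_; mk⇔; Equivalence)
open import Level using (0ℓ)
open import Relation.Binary.Definitions using (DecidableEquality)
open import Relation.Nullary using (¬_; Dec; yes; no; ¬?; contradiction; _×-dec_)
open import Relation.Unary using (Pred; Decidable)
open import Relation.Binary.PropositionalEquality using (_≡_; _≢_; refl; sym; trans; cong; subst; module ≡-Reasoning)

private variable
  A B : Set

Unique-⊆⇒length≤ : ∀ {xs ys : List A} → Unique xs → xs ⊆ ys → length xs ≤ length ys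
Unique-⊆⇒length≤ {xs = []} _ _ = z≤n
Unique-⊆⇒length≤ {xs = x ∷ xs} (x∉xs ∷ xs!) xs⊆ys
  with ys₁ , ys₂ , refl ← ∈-∃++ (xs⊆ys (here refl)) =
  ≤-trans (s≤s (Unique-⊆⇒length≤ xs! xs⊆ys₁ys₂)) (≤-reflexive (sym (↭-length (shift x ys₁ ys₂))))
  where
  xs⊆ys₁ys₂ : xs ⊆ ys₁ ++ ys₂
  xs⊆ys₁ys₂ y∈xs with ∈-resp-↭ (shift x ys₁ ys₂) (xs⊆ys (there y∈xs))
  ... | here refl = contradiction refl (All.lookup x∉xs y∈xs)
  ... | there y∈ys₁ys₂ = y∈ys₁ys₂

map⁺-injectiveOn : ∀ {f : A → B} {xs} → (∀ {x y} → x ∈ xs → y ∈ xs → f x ≡ f y → x ≡ y) →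
                   Unique xs → Unique (map f xs)
map⁺-injectiveOn {xs = []} _ [] = []
map⁺-injectiveOn {xs = x ∷ xs} inj (x∉xs ∷ xs!) =
  All-map⁺ (All.tabulate (λ y∈xs fx≡fy → All.lookup x∉xs y∈xs (inj (here refl) (there y∈xs) fx≡fy)))
  ∷ map⁺-injectiveOn (λ x∈ y∈ → inj (there x∈) (there y∈)) xs!

length-cartesianProductWith : ∀ {C : Set} (f : A → B → C) xs ys →
                              length (cartesianProductWith f xs ys) ≡ length xs * length ys
length-cartesianProductWith f [] ys = refl
length-cartesianProductWith f (x ∷ xs) ys
  rewrite length-++ (map (f x) ys) {cartesianProductWith f xs ys}
        | length-map (f x) ys
        | length-cartesianProductWith f xs ys = refl

filter-cong-on : ∀ {P Q : Pred A 0ℓ} (P? : Decidable P) (Q? : Decidable Q) {xs} →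
                 All (λ x → P x ⇔ Q x) xs → filter P? xs ≡ filter Q? xs
filter-cong-on P? Q? [] = refl
filter-cong-on P? Q? {x ∷ xs} (Px⇔Qx ∷ rest) with P? x | Q? x
... | yes _  | yes _  = cong (x ∷_) (filter-cong-on P? Q? rest)
... | no _   | no _   = filter-cong-on P? Q? rest
... | yes Px | no ¬Qx = contradiction (Equivalence.to Px⇔Qx Px) ¬Qx
... | no ¬Px | yes Qx = contradiction (Equivalence.from Px⇔Qx Qx) ¬Px

sublists : List A → List (List A)
sublists [] = [ [] ]
sublists (x ∷ xs) = map (x ∷_) (sublists xs) ++ sublists xs

sublists-⊆ : ∀ {xs ys : List A} → ys ∈ sublists xs → ys ⊆ xs
sublists-⊆ {xs = []} (here refl) ()
sublists-⊆ {xs = x ∷ xs} ys∈ y∈ys with ∈-++⁻ (map (x ∷_) (sublists xs)) ys∈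
... | inj₂ ys∈′ = there (sublists-⊆ ys∈′ y∈ys)
... | inj₁ x∷ys∈ with ys′ , ys′∈ , refl ← ∈-map⁻ (x ∷_) x∷ys∈ with y∈ys
... | here y≡x = here y≡x
... | there y∈ys′ = there (sublists-⊆ ys′∈ y∈ys′)

Unique-sublists : ∀ {xs ys : List A} → Unique xs → ys ∈ sublists xs → Unique ys
Unique-sublists {xs = []} _ (here refl) = []
Unique-sublists {xs = x ∷ xs} (x∉xs ∷ xs!) ys∈ with ∈-++⁻ (map (x ∷_) (sublists xs)) ys∈
... | inj₂ ys∈′ = Unique-sublists xs! ys∈′
... | inj₁ x∷ys∈ with ys′ , ys′∈ , refl ← ∈-map⁻ (x ∷_) x∷ys∈ =
  All.tabulate (λ y∈ys′ → All.lookup x∉xs (sublists-⊆ ys′∈ y∈ys′)) ∷ Unique-sublists xs! ys′∈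

filter∈sublists : ∀ {P : Pred A 0ℓ} (P? : Decidable P) xs → filter P? xs ∈ sublists xs
filter∈sublists P? [] = here refl
filter∈sublists P? (x ∷ xs) with P? x
... | yes _ = ∈-++⁺ˡ (∈-map⁺ (x ∷_) (filter∈sublists P? xs))
... | no _  = ∈-++⁺ʳ (map (x ∷_) (sublists xs)) (filter∈sublists P? xs)

words : List A → ℕ → List (List A)
words S zero = [ [] ]
words S (suc l) = cartesianProductWith _∷_ S (words S l)

∈-words : ∀ {S : List A} σ → All (_∈ S) σ → σ ∈ words S (length σ)
∈-words [] [] = here refl
∈-words (x ∷ σ) (x∈S ∷ σ⊆S) = ∈-cartesianProductWith⁺ _∷_ x∈S (∈-words σ σ⊆S)

maximum-attained : ∀ {X : Set} {P : Pred X 0ℓ} (P? : Decidable P) (size : X → ℕ) {x₀} cs → P x₀ →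
                   (∀ {x} → P x → ∃ λ c → c ∈ cs × P c × size x ≤ size c) →
                   ∃ λ m → (∃ λ x → P x × size x ≡ m) × (∀ x → P x → size x ≤ m)
maximum-attained {P = P} P? size {x₀} cs Px₀ covered =
  size best , (best , argmax-all size Px₀ (all-filter P? cs) , refl) , bound
  where
  best = argmax size x₀ (filter P? cs)
  bound : ∀ x → P x → size x ≤ size best
  bound x Px with c , c∈cs , Pc , x≤c ← covered Px =
    ≤-trans x≤c (All.lookup (f[xs]≤f[argmax] {f = size} x₀ (filter P? cs)) (∈-filter⁺ P? c∈cs Pc))

module WithDecidableEquality {X : Set} (_≟X_ : DecidableEquality X) where
  open DecMembership _≟X_ using (_∈?_)

  _↭?_ : (xs ys : List X) → Dec (xs ↭ ys)
  [] ↭? [] = yes ↭-refl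
  [] ↭? (y ∷ ys) = no (λ p → ¬x∷xs↭[] (↭-sym p))
  (x ∷ xs) ↭? ys with any? (x ≟X_) ys
  ... | no x∉ys = no (λ p → x∉ys (∈-resp-↭ p (here refl)))
  ... | yes x∈ys with ys₁ , ys₂ , refl ← ∈-∃++ x∈ys with xs ↭? (ys₁ ++ ys₂)
  ...   | yes p = yes (↭-trans (↭-prep x p) (↭-sym (shift x ys₁ ys₂)))
  ...   | no ¬p = no (λ q → ¬p (drop-mid [] ys₁ q))

  restrict : List X → List X → List X
  restrict S xs = filter (_∈? xs) S

  restrict-⊆ : ∀ S xs → restrict S xs ⊆ xs
  restrict-⊆ S xs x∈ = proj₂ (∈-filter⁻ (_∈? xs) {xs = S} x∈)

  ⊆-restrict : ∀ {S xs} → xs ⊆ S → xs ⊆ restrict S xs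
  ⊆-restrict {xs = xs} xs⊆S x∈xs = ∈-filter⁺ (_∈? xs) (xs⊆S x∈xs) x∈xs

  restrict∈sublists : ∀ S xs → restrict S xs ∈ sublists S
  restrict∈sublists S xs = filter∈sublists (_∈? xs) S

  Unique-restrict : ∀ {S} xs → Unique S → Unique (restrict S xs)
  Unique-restrict xs = Unique-filter⁺ (_∈? xs)

open WithDecidableEquality hiding (_↭?_)
open WithDecidableEquality _≟_ using (_↭?_)

_≟L_ : DecidableEquality (List ℕ)
_≟L_ = ≡-dec _≟_

symbols-Unique : ∀ n → Unique (symbols n)
symbols-Unique n = applyUpTo⁺₁ suc n (λ i<j _ eq → <⇒≢ i<j (suc-injective eq))

∈-symbols⇒≤ : ∀ {n x} → x ∈ symbols n → x ≤ n
∈-symbols⇒≤ x∈ with _ , i<n , refl ← ∈-applyUpTo⁻ suc x∈ = i<n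

suc∉symbols : ∀ {n} → suc n ∉ symbols n
suc∉symbols n+1∈ = <⇒≢ (∈-symbols⇒≤ n+1∈) refl

symbols-suc : ∀ n → symbols (suc n) ≡ symbols n ++ [ suc n ]
symbols-suc n = sym (applyUpTo-∷ʳ suc n)

symbols-⊆-suc : ∀ {n} → symbols n ⊆ symbols (suc n)
symbols-⊆-suc {n} x∈ = subst (_ ∈_) (sym (symbols-suc n)) (∈-++⁺ˡ x∈)

suc∈symbols-suc : ∀ n → suc n ∈ symbols (suc n)
suc∈symbols-suc n = subst (suc n ∈_) (sym (symbols-suc n)) (∈-++⁺ʳ (symbols n) (here refl))

IsPerm⇒length≡ : ∀ {n σ} → IsPerm n σ → length σ ≡ n
IsPerm⇒length≡ {n} σ↭ = trans (↭-length σ↭) (length-applyUpTo suc n)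

IsPerm⇒suc∉ : ∀ {n σ} → IsPerm n σ → suc n ∉ σ
IsPerm⇒suc∉ σ↭ n+1∈σ = suc∉symbols (∈-resp-↭ σ↭ n+1∈σ)

IsPerm-∷ : ∀ {n σ} → IsPerm n σ → IsPerm (suc n) (suc n ∷ σ)
IsPerm-∷ {n} σ↭ = ↭-trans (↭-prep (suc n) σ↭)
  (↭-trans (++-comm [ suc n ] (symbols n)) (↭-reflexive (sym (symbols-suc n))))

universe : ℕ → List (List ℕ)
universe n = deduplicate _≟L_ (words (symbols n) n)

universe-Unique : ∀ n → Unique (universe n)
universe-Unique n = DecUniqueProperties.deduplicate-! _≟L_ (words (symbols n) n)

IsPerm⇒∈universe : ∀ {n σ} → IsPerm n σ → σ ∈ universe n
IsPerm⇒∈universe {n} {σ} σ↭ = ∈-deduplicate⁺ _≟L_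
  (subst (λ l → σ ∈ words (symbols n) l) (IsPerm⇒length≡ σ↭)
    (∈-words σ (All.tabulate (∈-resp-↭ σ↭))))

-- Only sublists of [1,…,n] need to be searched: listing the elements of a deletion
-- set A in increasing order changes neither its effect nor its size.
UlamLe? : ∀ n k α β → Dec (UlamLe n k α β)
UlamLe? n k α β with any? (λ A → (length A ≤? k) ×-dec ((α - A) ≟L (β - A))) (sublists (symbols n))
... | yes found with A , A∈ , A≤k , α-A≡β-A ← find found =
  yes (A , Unique-sublists (symbols-Unique n) A∈ , All.tabulate (sublists-⊆ A∈) , A≤k , α-A≡β-A)
... | no none = no λ (A , _ , A⊆ , A≤k , α-A≡β-A) →
  let A′ = restrict _≟_ (symbols n) A
      same : ∀ γ → γ - A′ ≡ γ - A
      same = filter-≐ (λ x → ¬? (x ∈? A′)) (λ x → ¬? (x ∈? A))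
        ( (λ x∉A′ x∈A → x∉A′ (⊆-restrict _≟_ (All.lookup A⊆) x∈A))
        , (λ x∉A x∈A′ → x∉A (restrict-⊆ _≟_ (symbols n) A x∈A′)))
      A′≤A = Unique-⊆⇒length≤ (Unique-restrict _≟_ A (symbols-Unique n)) (restrict-⊆ _≟_ (symbols n) A)
  in none (lose (restrict∈sublists _≟_ (symbols n) A)
       (≤-trans A′≤A A≤k , trans (same α) (trans α-A≡β-A (sym (same β)))))
  where open DecMembership _≟_ using (_∈?_)

IsKFamily? : ∀ k n F → Dec (IsKFamily k n F)
IsKFamily? k n F
  with DecUnique.unique? _≟L_ F
     | All.all? (λ σ → σ ↭? symbols n) F
     | All.all? (λ α → All.all? (UlamLe? n k α) F) F
... | no ¬F! | _ | _ = no (λ fam → ¬F! (proj₁ fam))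
... | yes _ | no ¬perms | _ = no (λ fam → ¬perms (proj₁ (proj₂ fam)))
... | yes _ | yes _ | no ¬close =
  no (λ (_ , _ , close) → ¬close (All.tabulate (λ α∈ → All.tabulate (close α∈))))
... | yes F! | yes perms | yes close = yes (F! , perms , λ α∈ β∈ → All.lookup (All.lookup close α∈) β∈)

IsKFamily-[] : ∀ {k n} → IsKFamily k n []
IsKFamily-[] = [] , [] , λ ()

IsKFamily-⊆ : ∀ {k n F G} → Unique G → G ⊆ F → IsKFamily k n F → IsKFamily k n G
IsKFamily-⊆ G! G⊆F (_ , perms , close) =
  G! , All.tabulate (λ σ∈G → All.lookup perms (G⊆F σ∈G)) , λ α∈ β∈ → close (G⊆F α∈) (G⊆F β∈)

f-exists : ∀ k n → ∃ (IsF k n)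
f-exists k n = maximum-attained (IsKFamily? k n) length (sublists (universe n)) IsKFamily-[] covered
  where
  covered : ∀ {F} → IsKFamily k n F → ∃ λ G → G ∈ sublists (universe n) × IsKFamily k n G × length F ≤ length G
  covered {F} fam@(F! , perms , _) =
    restrict _≟L_ (universe n) F ,
    restrict∈sublists _≟L_ (universe n) F ,
    IsKFamily-⊆ (Unique-restrict _≟L_ F (universe-Unique n)) (restrict-⊆ _≟L_ (universe n) F) fam ,
    Unique-⊆⇒length≤ F! (⊆-restrict _≟L_ (λ σ∈F → IsPerm⇒∈universe (All.lookup perms σ∈F)))

IsF-transfer : ∀ {k n k′ n′} (g : ℕ → ℕ) →
               (∀ {F} → IsKFamily k n F → ∃ λ G → IsKFamily k′ n′ G × g (length F) ≤ length G) →
               ∃ λ a → ∃ λ b → IsF k n a × IsF k′ n′ b × g a ≤ b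
IsF-transfer {k} {n} {k′} {n′} g transform
  with f-exists k n | f-exists k′ n′
... | a , fa@((F , famF , refl) , _) | b , fb@(_ , maximal)
  with G , famG , gF≤G ← transform famF = a , b , fa , fb , ≤-trans gF≤G (maximal G famG)

UlamLe-mono : ∀ {n k k′ α β} → k ≤ k′ → UlamLe n k α β → UlamLe n k′ α β
UlamLe-mono k≤k′ (A , A! , A⊆ , A≤k , eq) = A , A! , A⊆ , ≤-trans A≤k k≤k′ , eq

IsKFamily-mono : ∀ {n k k′ F} → k ≤ k′ → IsKFamily k n F → IsKFamily k′ n F
IsKFamily-mono k≤k′ (F! , perms , close) = F! , perms , λ {α} {β} α∈ β∈ → UlamLe-mono {α = α} {β} k≤k′ (close α∈ β∈)

minus-∷-∉ : ∀ {x} α A → x ∉ A → (x ∷ α) - A ≡ x ∷ (α - A)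
minus-∷-∉ α A = filter-accept (λ y → ¬? (y ∈? A))
  where open DecMembership _≟_ using (_∈?_)

minus-fresh : ∀ {m} σ A → m ∉ σ → σ - (m ∷ A) ≡ σ - A
minus-fresh {m} σ A m∉σ = filter-cong-on (λ x → ¬? (x ∈? (m ∷ A))) (λ x → ¬? (x ∈? A)) (All.tabulate same)
  where
  open DecMembership _≟_ using (_∈?_)
  same : ∀ {x} → x ∈ σ → (x ∉ m ∷ A) ⇔ (x ∉ A)
  same x∈σ = mk⇔ (λ x∉mA x∈A → x∉mA (there x∈A))
                 (λ { x∉A (here refl) → m∉σ x∈σ ; x∉A (there x∈A) → x∉A x∈A })

UlamLe-∷ : ∀ {n k α β} → UlamLe n k α β → UlamLe (suc n) k (suc n ∷ α) (suc n ∷ β)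
UlamLe-∷ {n} {α = α} {β} (A , A! , A⊆ , A≤k , α-A≡β-A) =
  A , A! , All.map symbols-⊆-suc A⊆ , A≤k , (begin
    (suc n ∷ α) - A  ≡⟨ minus-∷-∉ α A n+1∉A ⟩
    suc n ∷ (α - A)  ≡⟨ cong (suc n ∷_) α-A≡β-A ⟩
    suc n ∷ (β - A)  ≡⟨ minus-∷-∉ β A n+1∉A ⟨
    (suc n ∷ β) - A  ∎)
  where
  open ≡-Reasoning
  n+1∉A : suc n ∉ A
  n+1∉A n+1∈A = suc∉symbols (All.lookup A⊆ n+1∈A)

IsKFamily-∷ : ∀ {k n F} → IsKFamily k n F → IsKFamily k (suc n) (map (suc n ∷_) F)
IsKFamily-∷ {k} {n} {F} (F! , perms , close) =
  Unique-map⁺ ∷-injectiveʳ F! , All-map⁺ (All.map IsPerm-∷ perms) , close′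
  where
  close′ : ∀ {α β} → α ∈ map (suc n ∷_) F → β ∈ map (suc n ∷_) F → UlamLe (suc n) k α β
  close′ α∈ β∈ with _ , α∈F , refl ← ∈-map⁻ (suc n ∷_) α∈ | _ , β∈F , refl ← ∈-map⁻ (suc n ∷_) β∈ =
    UlamLe-∷ (close α∈F β∈F)

-- Unlike the library's insertAt, the position is a plain number; positions
-- beyond the end append.
insertAt′ : List A → ℕ → A → List A
insertAt′ xs zero v = v ∷ xs
insertAt′ [] (suc i) v = [ v ]
insertAt′ (x ∷ xs) (suc i) v = x ∷ insertAt′ xs i v

insertAt′-↭ : ∀ (xs : List A) i v → insertAt′ xs i v ↭ v ∷ xs
insertAt′-↭ xs zero v = ↭-refl
insertAt′-↭ [] (suc i) v = ↭-refl
insertAt′-↭ (x ∷ xs) (suc i) v = ↭-trans (↭-prep x (insertAt′-↭ xs i v)) (↭-swap x v ↭-refl)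

filter-insertAt′-reject : ∀ {P : Pred A 0ℓ} (P? : Decidable P) {v} xs i →
                          ¬ P v → filter P? (insertAt′ xs i v) ≡ filter P? xs
filter-insertAt′-reject P? xs zero ¬Pv = filter-reject P? ¬Pv
filter-insertAt′-reject P? [] (suc i) ¬Pv = filter-reject P? ¬Pv
filter-insertAt′-reject P? (x ∷ xs) (suc i) ¬Pv with P? x
... | yes _ = cong (x ∷_) (filter-insertAt′-reject P? xs i ¬Pv)
... | no _  = filter-insertAt′-reject P? xs i ¬Pv

insertAt′-injective : ∀ {v : A} xs ys i j → v ∉ xs → v ∉ ys → i ≤ length xs → j ≤ length ys →
                      insertAt′ xs i v ≡ insertAt′ ys j v → i ≡ j × xs ≡ ys
insertAt′-injective xs ys zero zero _ _ _ _ eq = refl , ∷-injectiveʳ eq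
insertAt′-injective xs (y ∷ ys) zero (suc j) _ v∉ys _ _ eq = contradiction (here (∷-injectiveˡ eq)) v∉ys
insertAt′-injective (x ∷ xs) ys (suc i) zero v∉xs _ _ _ eq = contradiction (here (sym (∷-injectiveˡ eq))) v∉xs
insertAt′-injective (x ∷ xs) (y ∷ ys) (suc i) (suc j) v∉xs v∉ys (s≤s i≤) (s≤s j≤) eq
  with refl , eq′ ← ∷-injective eq
  with refl , refl ← insertAt′-injective xs ys i j (v∉xs ∘ there) (v∉ys ∘ there) i≤ j≤ eq′ = refl , refl

IsPerm-insertAt′ : ∀ {n σ} i → IsPerm n σ → IsPerm (suc n) (insertAt′ σ i (suc n))
IsPerm-insertAt′ {n} {σ} i σ↭ = ↭-trans (insertAt′-↭ σ i (suc n)) (IsPerm-∷ σ↭)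

minus-insertAt′ : ∀ {m} σ i A → m ∉ σ → insertAt′ σ i m - (m ∷ A) ≡ σ - A
minus-insertAt′ {m} σ i A m∉σ =
  trans (filter-insertAt′-reject (λ x → ¬? (x ∈? (m ∷ A))) σ i (λ m∉mA → m∉mA (here refl)))
        (minus-fresh σ A m∉σ)
  where open DecMembership _≟_ using (_∈?_)

UlamLe-insertAt′ : ∀ {n k α β} i j → IsPerm n α → IsPerm n β → UlamLe n k α β →
                   UlamLe (suc n) (suc k) (insertAt′ α i (suc n)) (insertAt′ β j (suc n))
UlamLe-insertAt′ {n} {α = α} {β} i j α↭ β↭ (A , A! , A⊆ , A≤k , α-A≡β-A) =
  suc n ∷ A , n+1∉A ∷ A! , suc∈symbols-suc n ∷ All.map symbols-⊆-suc A⊆ , s≤s A≤k , (begin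
    insertAt′ α i (suc n) - (suc n ∷ A)  ≡⟨ minus-insertAt′ α i A (IsPerm⇒suc∉ α↭) ⟩
    α - A                               ≡⟨ α-A≡β-A ⟩
    β - A                               ≡⟨ minus-insertAt′ β j A (IsPerm⇒suc∉ β↭) ⟨
    insertAt′ β j (suc n) - (suc n ∷ A)  ∎)
  where
  open ≡-Reasoning
  n+1∉A : All (suc n ≢_) A
  n+1∉A = All.map (λ x∈symbols n+1≡x → suc∉symbols (subst (_∈ symbols n) (sym n+1≡x) x∈symbols)) A⊆

insertEverywhere : ℕ → List (List ℕ) → List (List ℕ)
insertEverywhere n F = map (λ (σ , i) → insertAt′ σ i (suc n)) (cartesianProduct F (upTo (suc n)))

length-insertEverywhere : ∀ n F → length (insertEverywhere n F) ≡ suc n * length F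
length-insertEverywhere n F = begin
  length (insertEverywhere n F)               ≡⟨ length-map _ (cartesianProduct F (upTo (suc n))) ⟩
  length (cartesianProduct F (upTo (suc n)))  ≡⟨ length-cartesianProductWith _,_ F (upTo (suc n)) ⟩
  length F * length (upTo (suc n))            ≡⟨ cong (length F *_) (length-upTo (suc n)) ⟩
  length F * suc n                            ≡⟨ *-comm (length F) (suc n) ⟩
  suc n * length F                            ∎
  where open ≡-Reasoning

IsKFamily-insertEverywhere : ∀ {k n F} → IsKFamily k n F → IsKFamily (suc k) (suc n) (insertEverywhere n F)
IsKFamily-insertEverywhere {k} {n} {F} (F! , perms , close) =
  map⁺-injectiveOn injective (cartesianProduct⁺ F! (upTo⁺ (suc n))) ,
  All-map⁺ (All.tabulate (λ {(σ , i)} σi∈ → IsPerm-insertAt′ i (proj₁ (valid σi∈)))) ,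
  close′
  where
  valid : ∀ {σ i} → (σ , i) ∈ cartesianProduct F (upTo (suc n)) → IsPerm n σ × i ≤ length σ
  valid σi∈ with σ∈F , i∈ ← ∈-cartesianProduct⁻ F (upTo (suc n)) σi∈ =
    All.lookup perms σ∈F , subst (_ ≤_) (sym (IsPerm⇒length≡ (All.lookup perms σ∈F))) (≤-pred (∈-upTo⁻ i∈))
  injective : ∀ {p q} → p ∈ cartesianProduct F (upTo (suc n)) → q ∈ cartesianProduct F (upTo (suc n)) →
              insertAt′ (proj₁ p) (proj₂ p) (suc n) ≡ insertAt′ (proj₁ q) (proj₂ q) (suc n) → p ≡ q
  injective {σ , i} {τ , j} σi∈ τj∈ eq
    with σ↭ , i≤ ← valid σi∈ | τ↭ , j≤ ← valid τj∈
    with refl , refl ← insertAt′-injective σ τ i j (IsPerm⇒suc∉ σ↭) (IsPerm⇒suc∉ τ↭) i≤ j≤ eq = refl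
  close′ : ∀ {α β} → α ∈ insertEverywhere n F → β ∈ insertEverywhere n F → UlamLe (suc n) (suc k) α β
  close′ α∈ β∈
    with (σ , i) , σi∈ , refl ← ∈-map⁻ _ α∈ | (τ , j) , τj∈ , refl ← ∈-map⁻ _ β∈
    with σ∈F , _ ← ∈-cartesianProduct⁻ F (upTo (suc n)) σi∈ | τ∈F , _ ← ∈-cartesianProduct⁻ F (upTo (suc n)) τj∈ =
    UlamLe-insertAt′ i j (All.lookup perms σ∈F) (All.lookup perms τ∈F) (close σ∈F τ∈F)

proposition5 : ∀ (k n : ℕ) → 1 ≤ n → k ≤ n →
      (∃ λ a → ∃ λ b → IsF k n a × IsF (suc k) n b × a ≤ b)
    × (∃ λ a → ∃ λ b → IsF k n a × IsF k (suc n) b × a ≤ b)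
    × (∃ λ a → ∃ λ b → IsF k n a × IsF (suc k) (suc n) b × suc n * a ≤ b)
proposition5 k n _ _ =
    IsF-transfer (λ a → a) (λ famF → _ , IsKFamily-mono (n≤1+n k) famF , ≤-refl)
  , IsF-transfer (λ a → a) (λ {F} famF →
      _ , IsKFamily-∷ famF , ≤-reflexive (sym (length-map (suc n ∷_) F)))
  , IsF-transfer (suc n *_) (λ {F} famF →
      _ , IsKFamily-insertEverywhere famF , ≤-reflexive (sym (length-insertEverywhere n F)))
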